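{- Let $m\in\mathbb N$, $L\in\mathcal{CS}_m$ and $L_0,\dots,L_{m-1}\in\mathcal H$ with $L=L_0+\cdots+L_{m-1}$, and let $\mathrm{Block}(L)=\{B_0,\dots,B_r\}$, where $B_0=L_0+\cdots+L_{n-1}$ is the block containing $L_0$. Then $\mathrm{Block}(L\setminus B_0)=\mathrm{Block}(L)\setminus\{B_0\}$, where the blocks of $L\setminus B_0$ are taken with respect to the decomposition $L\setminus B_0=L_n+\cdots+L_{m-1}$.
   Context: $X\hookrightarrow Y$ means $X$ order-embeds into $Y$. $\sum_\omega L_i=L_0+L_1+\cdots$ and $\sum_{\omega^*}L_i=\cdots+L_1+L_0$. A sequence $\langle L_i:i\in\omega\rangle$ satisfies $(*)$ if for each $i$ the set $\{j:L_i\hookrightarrow L_j\}$ is infinite. $\mathcal H$ is the smallest class of order types of countable linear orders containing the one-element type and containing $\sum_\omega L_i$ and $\sum_{\omega^*}L_i$ for every sequence in $\mathcal H$ satisfying $(*)$. An $\omega$-sum (resp. $\omega^*$-sum) is an order $\sum_\omega L_i$ (resp. $\sum_{\omega^*}L_i$) for such a sequence. $\mathcal{CS}$ is the class of countable scattered linear orders, $m(L)$ the least $n$ such that $L$ is a sum of $n$ elements of $\mathcal H$, $\mathcal{CS}_m=\{L\in\mathcal{CS}:m(L)=m\}$. Given a decomposition $L=L_0+\cdots+L_{m-1}$ into elements of $\mathcal H$, a block is a sum $B=L_i+\cdots+L_{i+k}$ of consecutive summands, $k\ge0$, satisfying one of: (A) $|L_j|=1$ for all $j\in\{i,\dots,i+k\}$,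 and ($i=0$ or $L_{i-1}$ is infinite) and ($i+k=m-1$ or $L_{i+k+1}$ is infinite); (B) $L_j$ is an $\omega$-sum for all $j\in\{i,\dots,i+k\}$, and ($i=0$ or ($L_{i-1}$ is an $\omega$-sum and $L_{i-2}$ is an $\omega^*$-sum)) and ($i+k=m-1$ or $L_{i+k+1}$ is not an $\omega$-sum); (C) $L_j$ is an $\omega^*$-sum for all $j\in\{i,\dots,i+k\}$, and ($i=0$ or $L_{i-1}$ is not an $\omega^*$-sum) and ($i+k=m-1$ or ($L_{i+k+1}$ is an $\omega^*$-sum and $L_{i+k+2}$ is an $\omega$-sum)); (D) $k=1$, $L_i$ is an $\omega^*$-sum and $L_{i+1}$ is an $\omega$-sum. $\mathrm{Block}(L)$ denotes the set of blocks. -}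

module Defs where

open import Level using (0ℓ)
open import Function.Base using (flip; _∘_)
open import Data.Empty using (⊥)
open import Data.Product using (Σ; Σ-syntax; ∃; _×_; _,_; proj₁; proj₂)
open import Data.Sum using (_⊎_)
open import Data.Nat as ℕ using (ℕ; zero; suc; _+_; _≤_)
import Data.Nat.Properties as ℕₚ
open import Data.Fin as Fin using (Fin; fromℕ<)
import Data.Fin.Properties as Finₚ
open import Data.Rational as ℚ using (ℚ)
import Data.Rational.Properties as ℚₚ
open import Data.List using (List; length; lookup)
open import Data.List.Relation.Unary.All using (All)
open import Relation.Nullary using (¬_)
open import Relation.Binary.Core using (Rel)
open import Relation.Binary.Structures using (IsStrictTotalOrder; IsStrictPartialOrder)
open import Relation.Binary.Definitions using (Trichotomous; tri<; tri≈; tri>)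
open import Relation.Binary.PropositionalEquality
  using (_≡_; refl; cong; resp₂; isEquivalence)
import Relation.Binary.Construct.Flip.EqAndOrd as Flip

record LinOrd : Set₁ where
  field
    Car    : Set
    _<_    : Rel Car 0ℓ
    isSTO  : IsStrictTotalOrder _≡_ _<_

open LinOrd public

Countable : LinOrd → Set
Countable L = Σ (Car L → ℕ) λ f → ∀ x y → f x ≡ f y → x ≡ y

_↪_ : LinOrd → LinOrd → Set
X ↪ Y = Σ (Car X → Car Y) λ f → ∀ x y → _<_ X x y → _<_ Y (f x) (f y)

_≅_ : LinOrd → LinOrd → Set
X ≅ Y = Σ (Car X → Car Y) λ f → Σ (Car Y → Car X) λ g →
          (∀ x → g (f x) ≡ x) × (∀ y → f (g y) ≡ y) ×
          (∀ x x' → _<_ X x x' → _<_ Y (f x) (f x')) ×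
          (∀ y y' → _<_ Y y y' → _<_ X (g y) (g y'))

IsOne : LinOrd → Set
IsOne L = Σ (Car L) λ x → ∀ y → y ≡ x

Finite : LinOrd → Set
Finite L = Σ ℕ λ n → Σ (Car L → Fin n) λ f → Σ (Fin n → Car L) λ g →
             (∀ x → g (f x) ≡ x) × (∀ k → f (g k) ≡ k)

Infinite : LinOrd → Set
Infinite L = ¬ Finite L

ωLO : LinOrd
ωLO = record { Car = ℕ ; _<_ = ℕ._<_ ; isSTO = ℕₚ.<-isStrictTotalOrder }

ω*LO : LinOrd
ω*LO = record { Car = ℕ ; _<_ = flip ℕ._<_
              ; isSTO = Flip.isStrictTotalOrder ℕₚ.<-isStrictTotalOrder }

FinLO : ℕ → LinOrd
FinLO n = record { Car = Fin n ; _<_ = Fin._<_ ; isSTO = Finₚ.<-isStrictTotalOrder }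

ηLO : LinOrd
ηLO = record { Car = ℚ ; _<_ = ℚ._<_ ; isSTO = ℚₚ.<-isStrictTotalOrder }

Scattered : LinOrd → Set
Scattered L = ¬ (ηLO ↪ L)

module SumConstr (I : LinOrd) (F : Car I → LinOrd) where

  C : Set
  C = Σ (Car I) (λ i → Car (F i))

  data Lex : C → C → Set where
    here  : ∀ {i j x y} → _<_ I i j → Lex (i , x) (j , y)
    there : ∀ {i x y} → _<_ (F i) x y → Lex (i , x) (i , y)

  private
    module I = IsStrictTotalOrder (isSTO I)
    module F (i : Car I) = IsStrictTotalOrder (isSTO (F i))

  lex-irrefl : ∀ {a b} → a ≡ b → ¬ Lex a b
  lex-irrefl refl (here p)  = I.irrefl refl p
  lex-irrefl refl (there {i} q) = F.irrefl i refl q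

  lex-trans : ∀ {a b c} → Lex a b → Lex b c → Lex a c
  lex-trans (here p)  (here q)  = here (I.trans p q)
  lex-trans (here p)  (there q) = here p
  lex-trans (there p) (here q)  = here q
  lex-trans (there {i} p) (there q) = there (F.trans i p q)

  lex-compare : Trichotomous _≡_ Lex
  lex-compare (i , x) (j , y) with I.compare i j
  ... | tri< a ¬b ¬c = tri< (here a) (λ e → ¬b (cong proj₁ e))
                            (λ { (here c) → ¬c c ; (there c) → ¬b refl })
  ... | tri> ¬a ¬b c = tri> (λ { (here a) → ¬a a ; (there a) → ¬b refl })
                            (λ e → ¬b (cong proj₁ e)) (here c)
  ... | tri≈ ¬a refl ¬c with F.compare i x y
  ...   | tri< a ¬b ¬c' = tri< (there a) (λ { refl → ¬b refl })
                             (λ { (here c) → ¬c c ; (there c) → ¬c' c })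
  ...   | tri≈ ¬a' refl ¬c' = tri≈ (λ { (here a) → ¬a a ; (there a) → ¬a' a }) refl
                             (λ { (here c) → ¬c c ; (there c) → ¬c' c })
  ...   | tri> ¬a' ¬b c = tri> (λ { (here a) → ¬a a ; (there a) → ¬a' a })
                             (λ { refl → ¬b refl }) (there c)

  SumLO : LinOrd
  SumLO = record
    { Car = C
    ; _<_ = Lex
    ; isSTO = record
      { isStrictPartialOrder = record
        { isEquivalence = isEquivalence
        ; irrefl = lex-irrefl
        ; trans = lex-trans
        ; <-resp-≈ = resp₂ Lex
        }
      ; compare = lex-compare
      }
    }

Sum : (I : LinOrd) → (Car I → LinOrd) → LinOrd
Sum I F = SumConstr.SumLO I F

ΣωLO : (ℕ → LinOrd) → LinOrd
ΣωLO = Sum ωLO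

Σω*LO : (ℕ → LinOrd) → LinOrd
Σω*LO = Sum ω*LO

FinSum : List LinOrd → LinOrd
FinSum Ls = Sum (FinLO (length Ls)) (lookup Ls)

-- Condition (*): for each i, {j : L_i ↪ L_j} is infinite (unbounded in ℕ).

Star : (ℕ → LinOrd) → Set
Star Ls = ∀ i → ∀ N → Σ ℕ λ j → N ≤ j × (Ls i ↪ Ls j)

-- The class ℋ (closed under isomorphism, i.e. a class of order types).
data ℋ : LinOrd → Set₁ where
  ℋ-one  : ∀ L → IsOne L → ℋ L
  ℋ-ω    : ∀ L (Ls : ℕ → LinOrd) → (∀ i → ℋ (Ls i)) → Star Ls →
           L ≅ ΣωLO Ls → ℋ L
  ℋ-ω*   : ∀ L (Ls : ℕ → LinOrd) → (∀ i → ℋ (Ls i)) → Star Ls →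
           L ≅ Σω*LO Ls → ℋ L

IsωSum : LinOrd → Set₁
IsωSum L = Σ (ℕ → LinOrd) λ Ls → (∀ i → ℋ (Ls i)) × Star Ls × (L ≅ ΣωLO Ls)

Isω*Sum : LinOrd → Set₁
Isω*Sum L = Σ (ℕ → LinOrd) λ Ls → (∀ i → ℋ (Ls i)) × Star Ls × (L ≅ Σω*LO Ls)

IsSumOfℋ : ℕ → LinOrd → Set₁
IsSumOfℋ n L = Σ (List LinOrd) λ Ls → length Ls ≡ n × All ℋ Ls × (L ≅ FinSum Ls)

CS : ℕ → LinOrd → Set₁
CS m L = Countable L × Scattered L × IsSumOfℋ m L × (∀ n → IsSumOfℋ n L → m ≤ n)

At : ∀ {ℓ} → List LinOrd → (LinOrd → Set ℓ) → ℕ → Set ℓ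
At Ls P j = Σ (j ℕ.< length Ls) λ p → P (lookup Ls (fromℕ< p))

AllIn : ∀ {ℓ} → List LinOrd → (LinOrd → Set ℓ) → ℕ → ℕ → Set ℓ
AllIn Ls P i k = ∀ j → i ≤ j → j ≤ i + k → At Ls P j

NotωSum Notω*Sum : LinOrd → Set₁
NotωSum L = ¬ IsωSum L
Notω*Sum L = ¬ Isω*Sum L

IsLast : List LinOrd → ℕ → ℕ → Set
IsLast Ls i k = suc (i + k) ≡ length Ls

BlockA BlockB BlockC BlockD : List LinOrd → ℕ → ℕ → Set₁
BlockA Ls i k =
  AllIn Ls (λ L → Level.Lift (Level.suc 0ℓ) (IsOne L)) i k ×
  (i ≡ 0 ⊎ Σ ℕ λ j → i ≡ suc j × At Ls (λ L → Level.Lift (Level.suc 0ℓ) (Infinite L)) j) ×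
  (IsLast Ls i k ⊎ At Ls (λ L → Level.Lift (Level.suc 0ℓ) (Infinite L)) (suc (i + k)))
  where import Level
BlockB Ls i k =
  AllIn Ls IsωSum i k ×
  (i ≡ 0 ⊎ Σ ℕ λ j → i ≡ suc (suc j) × At Ls IsωSum (suc j) × At Ls Isω*Sum j) ×
  (IsLast Ls i k ⊎ At Ls NotωSum (suc (i + k)))
BlockC Ls i k =
  AllIn Ls Isω*Sum i k ×
  (i ≡ 0 ⊎ Σ ℕ λ j → i ≡ suc j × At Ls Notω*Sum j) ×
  (IsLast Ls i k ⊎ (At Ls Isω*Sum (suc (i + k)) × At Ls IsωSum (suc (suc (i + k)))))
BlockD Ls i k =
  k ≡ 1 × At Ls Isω*Sum i × At Ls IsωSum (suc i)

IsBlock : List LinOrd → ℕ → ℕ → Set₁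
IsBlock Ls i k = BlockA Ls i k ⊎ BlockB Ls i k ⊎ BlockC Ls i k ⊎ BlockD Ls i k

module Submission where

-- Two order-theoretic facts about the summands do all the work:
--   (1) every summand is exactly one of a singleton, an ω-sum, an ω*-sum:
--       singletons are finite, sums are infinite, and an order that is both
--       an ω-sum and an ω*-sum contains a copy of η, impossible inside the
--       scattered L.  To find η we embed ℚ into the binary tree of words
--       via Stern–Brocot paths, and the tree into any order with suitable
--       "go left"/"go right" self-embeddings, which condition (*) supplies;
--   (2) by minimality of m, no singleton is immediately followed by an
--       ω-sum: x + Σ_ω Aᵢ is again an ω-sum, and merging would decompose L
--       into m - 1 elements of ℋ.  Each block condition splits into a core
-- (conditions on Lᵢ, Lᵢ₊₁, …) and a left part (on Lᵢ₋₁, Lᵢ₋₂).  Cores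
-- commute with dropping summands; left parts do too, except right after B₀,
-- where (1) and (2) decide them.  Finally no other block starts inside B₀.

open import Defs hiding (_<_)
open import Level using (0ℓ; Lift; lift; lower) renaming (suc to lsuc)
open import Function.Base using (_∘_)
open import Function.Bundles using (_⇔_; mk⇔)
open import Data.Empty using (⊥; ⊥-elim)
open import Data.Unit.Polymorphic using (⊤)
open import Data.Product using (Σ; _×_; _,_; proj₁; proj₂)
open import Data.Sum using (_⊎_; inj₁; inj₂) renaming (map to ⊎-map)
open import Data.Nat as ℕ using (ℕ; zero; suc; _+_; _*_; _∸_; _≤_; _<_; z≤n; s≤s)
open import Data.Nat.Properties
open import Data.Integer using (+_; -[1+_]; +<+; -<-)
open import Data.Rational as ℚ using (ℚ; mkℚ; *<*)
open import Data.Fin as Fin using (toℕ)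
import Data.Fin.Properties as Finₚ
open import Data.List using (List; []; _∷_; length; lookup; drop)
open import Data.List.Relation.Unary.All using (All; []; _∷_)
open import Relation.Nullary using (¬_; yes; no)
open import Relation.Binary.PropositionalEquality
open import Relation.Binary.Core using (Rel)
open import Relation.Binary.Structures using (IsStrictTotalOrder)
import Relation.Binary.Construct.Flip.EqAndOrd as Flip
open import Relation.Binary.Definitions using (tri<; tri≈; tri>)

_∋_≺_ : (M : LinOrd) → Car M → Car M → Set
M ∋ x ≺ y = LinOrd._<_ M x y

-- η embeds into the binary tree of words.
--
-- Words over {l, r}, ordered left-to-right as nodes of the infinite binary
-- tree (in-order).  We embed ℚ into this order via Stern–Brocot paths.

data Word : Set where
  ε   : Word
  l r : Word → Word

data _⊏_ : Word → Word → Set where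
  l-ε : ∀ {u}   → l u ⊏ ε
  ε-r : ∀ {v}   → ε ⊏ r v
  l-r : ∀ {u v} → l u ⊏ r v
  l-l : ∀ {u v} → u ⊏ v → l u ⊏ l v
  r-r : ∀ {u v} → u ⊏ v → r u ⊏ r v

mirror : Word → Word
mirror ε     = ε
mirror (l w) = r (mirror w)
mirror (r w) = l (mirror w)

mirror-⊏ : ∀ {u v} → u ⊏ v → mirror v ⊏ mirror u
mirror-⊏ l-ε     = ε-r
mirror-⊏ ε-r     = l-ε
mirror-⊏ l-r     = l-r
mirror-⊏ (l-l p) = r-r (mirror-⊏ p)
mirror-⊏ (r-r p) = l-l (mirror-⊏ p)

-- The Stern–Brocot path of the fraction a/b (a, b ≥ 1), computed with
-- fuel F ≥ a + b: subtract the smaller of a, b from the larger.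
sbPath : ℕ → ℕ → ℕ → Word
sbPath zero    a b = ε
sbPath (suc F) a b with <-cmp a b
... | tri< _ _ _ = l (sbPath F a (b ∸ a))
... | tri≈ _ _ _ = ε
... | tri> _ _ _ = r (sbPath F (a ∸ b) b)

-- Arithmetic behind one step of the path: the cross-multiplied comparison
-- a/b < c/d survives subtracting the smaller coordinate on both sides.
cross-stepˡ : ∀ {a b c d} → a * d < c * b → c ≤ d → a * (d ∸ c) < c * (b ∸ a)
cross-stepˡ {a} {b} {c} {d} lt c≤d =
  subst₂ _<_ (sym (*-distribˡ-∸ a d c)) (sym (*-distribˡ-∸ c b a))
    (subst (λ z → a * d ∸ a * c < c * b ∸ z) (*-comm a c)
      (∸-monoˡ-< lt (*-monoʳ-≤ a c≤d)))

cross-stepʳ : ∀ {a b c d} → a * d < c * b → b ≤ a → (a ∸ b) * d < (c ∸ d) * b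
cross-stepʳ {a} {b} {c} {d} lt b≤a =
  subst₂ _<_ (sym (*-distribʳ-∸ d a b)) (sym (*-distribʳ-∸ b c d))
    (subst (λ z → a * d ∸ b * d < c * b ∸ z) (*-comm b d)
      (∸-monoˡ-< lt (*-monoˡ-≤ d b≤a)))

fuel-shrink : ∀ {a b F} → 1 ≤ a → a + b ≤ suc F → b ≤ F
fuel-shrink {suc a} {b} _ (s≤s h) = ≤-trans (m≤n+m b a) h

fuel-stepˡ : ∀ {a b F} → 1 ≤ a → a < b → a + b ≤ suc F → a + (b ∸ a) ≤ F
fuel-stepˡ {a} {b} {F} a≥1 a<b h = subst (_≤ F) (sym (m+[n∸m]≡n (<⇒≤ a<b))) (fuel-shrink {a} {b} a≥1 h)

fuel-stepʳ : ∀ {a b F} → 1 ≤ b → b < a → a + b ≤ suc F → (a ∸ b) + b ≤ F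
fuel-stepʳ {a} {b} {F} b≥1 b<a h =
  subst (_≤ _) (sym (m∸n+n≡m (<⇒≤ b<a))) (fuel-shrink {b} {a} b≥1 (subst (_≤ suc F) (+-comm a b) h))

sbPath-mono : ∀ F G a b c d → 1 ≤ a → 1 ≤ b → 1 ≤ c → 1 ≤ d →
              a + b ≤ F → c + d ≤ G → a * d < c * b → sbPath F a b ⊏ sbPath G c d
sbPath-mono zero G a b c d (s≤s _) _ _ _ () _ _
sbPath-mono (suc F) zero a b c d _ _ (s≤s _) _ _ () _
sbPath-mono (suc F) (suc G) a b c d a≥1 b≥1 c≥1 d≥1 hF hG lt
  with <-cmp a b | <-cmp c d
... | tri< a<b _ _ | tri< c<d _ _ =
  l-l (sbPath-mono F G a (b ∸ a) c (d ∸ c) a≥1 (m<n⇒0<n∸m a<b) c≥1 (m<n⇒0<n∸m c<d)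
        (fuel-stepˡ a≥1 a<b hF) (fuel-stepˡ c≥1 c<d hG) (cross-stepˡ {a} lt (<⇒≤ c<d)))
... | tri< _ _ _ | tri≈ _ _ _ = l-ε
... | tri< _ _ _ | tri> _ _ _ = l-r
... | tri≈ _ refl _ | tri< c<d _ _ =
  ⊥-elim (<-asym c<d (*-cancelˡ-< a d c (subst (a * d <_) (*-comm c a) lt)))
... | tri≈ _ refl _ | tri≈ _ refl _ = ⊥-elim (<-irrefl (*-comm a c) lt)
... | tri≈ _ _ _ | tri> _ _ _ = ε-r
... | tri> _ _ b<a | tri< c<d _ _ =
  ⊥-elim (<-asym lt (≤-<-trans (*-monoʳ-≤ c (<⇒≤ b<a))
    (subst (c * a <_) (*-comm d a) (*-monoˡ-< a {{ℕ.>-nonZero a≥1}} c<d))))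
... | tri> _ _ b<a | tri≈ _ refl _ =
  ⊥-elim (<-irrefl refl (<-≤-trans lt (subst (c * b ≤_) (*-comm c a) (*-monoʳ-≤ c (<⇒≤ b<a)))))
... | tri> _ _ b<a | tri> _ _ d<c =
  r-r (sbPath-mono F G (a ∸ b) b (c ∸ d) d (m<n⇒0<n∸m b<a) b≥1 (m<n⇒0<n∸m d<c) d≥1
        (fuel-stepʳ b≥1 b<a hF) (fuel-stepʳ d≥1 d<c hG) (cross-stepʳ {a} lt (<⇒≤ b<a)))

sbPos : ℕ → ℕ → Word
sbPos n d = sbPath (suc n + suc d) (suc n) (suc d)

sbPos-mono : ∀ n d n' d' → suc n * suc d' < suc n' * suc d → sbPos n d ⊏ sbPos n' d'
sbPos-mono n d n' d' =
  sbPath-mono _ _ (suc n) (suc d) (suc n') (suc d') (s≤s z≤n) (s≤s z≤n) (s≤s z≤n) (s≤s z≤n) ≤-refl ≤-refl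

toWord : ℚ → Word
toWord (mkℚ (+ zero)  d _) = ε
toWord (mkℚ (+ suc n) d _) = r (sbPos n d)
toWord (mkℚ -[1+ n ]  d _) = l (mirror (sbPos n d))

toWord-mono : ∀ p q → p ℚ.< q → toWord p ⊏ toWord q
toWord-mono (mkℚ (+ zero) _ _)  (mkℚ (+ zero) _ _)   (*<* (+<+ ()))
toWord-mono (mkℚ (+ zero) _ _)  (mkℚ (+ suc _) _ _)  _ = ε-r
toWord-mono (mkℚ (+ zero) _ _)  (mkℚ -[1+ _ ] _ _)   (*<* ())
toWord-mono (mkℚ (+ suc _) _ _) (mkℚ (+ zero) _ _)   (*<* (+<+ ()))
toWord-mono (mkℚ (+ suc n) d _) (mkℚ (+ suc n') d' _) (*<* (+<+ lt)) = r-r (sbPos-mono n d n' d' lt)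
toWord-mono (mkℚ (+ suc _) _ _) (mkℚ -[1+ _ ] _ _)   (*<* ())
toWord-mono (mkℚ -[1+ _ ] _ _)  (mkℚ (+ zero) _ _)   _ = l-ε
toWord-mono (mkℚ -[1+ _ ] _ _)  (mkℚ (+ suc _) _ _)  _ = l-r
toWord-mono (mkℚ -[1+ n ] d _)  (mkℚ -[1+ n' ] d' _) (*<* (-<- lt)) =
  l-l (mirror-⊏ (sbPos-mono n' d' n d (s≤s lt)))

↪-trans : ∀ {X Y Z} → X ↪ Y → Y ↪ Z → X ↪ Z
↪-trans (f , f-mono) (g , g-mono) = g ∘ f , λ x y p → g-mono _ _ (f-mono x y p)

≅-refl : ∀ {X} → X ≅ X
≅-refl = (λ x → x) , (λ x → x) , (λ _ → refl) , (λ _ → refl) , (λ _ _ p → p) , (λ _ _ p → p)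

≅-trans : ∀ {X Y Z} → X ≅ Y → Y ≅ Z → X ≅ Z
≅-trans (f , g , gf , fg , f-mono , g-mono) (f' , g' , gf' , fg' , f'-mono , g'-mono) =
  f' ∘ f , g ∘ g' ,
  (λ x → trans (cong g (gf' (f x))) (gf x)) , (λ z → trans (cong f' (fg (g' z))) (fg' z)) ,
  (λ x y p → f'-mono _ _ (f-mono x y p)) , (λ x y p → g-mono _ _ (g'-mono x y p))

-- Between linear orders, a monotone bijection is an isomorphism: its
-- inverse is automatically monotone, by trichotomy.
monotone-bijection⇒≅ : ∀ {X Y} (f : Car X → Car Y) (g : Car Y → Car X) →
  (∀ x → g (f x) ≡ x) → (∀ y → f (g y) ≡ y) →
  (∀ x x' → X ∋ x ≺ x' → Y ∋ f x ≺ f x') → X ≅ Y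
monotone-bijection⇒≅ {X} {Y} f g gf fg f-mono = f , g , gf , fg , f-mono , g-mono
  where
  module X = IsStrictTotalOrder (isSTO X)
  module Y = IsStrictTotalOrder (isSTO Y)
  g-mono : ∀ y y' → Y ∋ y ≺ y' → X ∋ g y ≺ g y'
  g-mono y y' y<y' with X.compare (g y) (g y')
  ... | tri< gy<gy' _ _ = gy<gy'
  ... | tri≈ _ gy≡gy' _ =
    ⊥-elim (Y.irrefl (trans (sym (fg y)) (trans (cong f gy≡gy') (fg y'))) y<y')
  ... | tri> _ _ gy'<gy =
    ⊥-elim (Y.irrefl refl (Y.trans y<y' (subst₂ (Y ∋_≺_) (fg y') (fg y) (f-mono _ _ gy'<gy))))

point : ∀ {M} → ℋ M → Car M
point (ℋ-one _ (x , _))             = x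
point (ℋ-ω _ _ h _ (_ , g , _))     = g (0 , point (h 0))
point (ℋ-ω* _ _ h _ (_ , g , _))    = g (0 , point (h 0))

singleton-finite : ∀ {M} → IsOne M → Finite M
singleton-finite (x , unique) =
  1 , (λ _ → Fin.zero) , (λ _ → x) , (λ y → sym (unique y)) , λ { Fin.zero → refl }

injective-sequence⇒infinite : ∀ {M} (h : ℕ → Car M) → (∀ i j → h i ≡ h j → i ≡ j) → Infinite M
injective-sequence⇒infinite h h-inj (n , f , g , gf , _)
  with Finₚ.pigeonhole (n<1+n n) (f ∘ h ∘ toℕ)
... | i , j , i<j , fhi≡fhj =
  <-irrefl (h-inj _ _ (trans (sym (gf _)) (trans (cong g fhi≡fhj) (gf _)))) i<j

-- A sum of nonempty orders over an infinite index order is infinite: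
-- choose one point in each summand.
sum-infinite : ∀ {M} (I : LinOrd) (A : Car I → LinOrd) → (∀ i → Car (A i)) →
  (e : ℕ → Car I) → (∀ i j → e i ≡ e j → i ≡ j) → M ≅ Sum I A → Infinite M
sum-infinite {M} I A pt e e-inj (f , g , _ , fg , _) =
  injective-sequence⇒infinite {M} (λ i → g (e i , pt (e i)))
    (λ i j eq → e-inj i j (cong proj₁ (trans (sym (fg _)) (trans (cong f eq) (fg _)))))

ωSum-infinite : ∀ {M} → IsωSum M → Infinite M
ωSum-infinite {M} (A , hA , _ , iso) = sum-infinite {M} ωLO A (λ i → point (hA i)) (λ i → i) (λ _ _ eq → eq) iso

ω*Sum-infinite : ∀ {M} → Isω*Sum M → Infinite M
ω*Sum-infinite {M} (A , hA , _ , iso) = sum-infinite {M} ω*LO A (λ i → point (hA i)) (λ i → i) (λ _ _ eq → eq) iso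

stepwise-increasing⇒monotone : (h : ℕ → ℕ) → (∀ i → h i < h (suc i)) →
  ∀ {i j} → i < j → h i < h j
stepwise-increasing⇒monotone h step {i} {suc j} (s≤s i≤j) with m≤n⇒m<n∨m≡n i≤j
... | inj₁ i<j  = <-trans (stepwise-increasing⇒monotone h step i<j) (step j)
... | inj₂ refl = step i

-- For a sum indexed by an order R on ℕ that is stable under increasing
-- reindexing (as ω and ω* are), condition (*) lets the whole sum embed
-- into its tail beyond any index n: send summand i into a later summand
-- js i, choosing js increasing.
module TailEmbedding (R : Rel ℕ 0ℓ) (R-sto : IsStrictTotalOrder _≡_ R)
  (R-stable : (h : ℕ → ℕ) → (∀ i → h i < h (suc i)) → ∀ {i j} → R i j → R (h i) (h j)) where

  Index : LinOrd
  Index = record { Car = ℕ ; _<_ = R ; isSTO = R-sto }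

  open SumConstr Index using (here; there)

  TailMap : (ℕ → LinOrd) → ℕ → Set
  TailMap A n = Σ (Car (Sum Index A) → Car (Sum Index A)) λ t →
    (∀ x y → Sum Index A ∋ x ≺ y → Sum Index A ∋ t x ≺ t y) × (∀ x → n ≤ proj₁ (t x))

  tail-embedding : (A : ℕ → LinOrd) → Star A → (n : ℕ) → TailMap A n
  tail-embedding A star n = t , t-mono , t-beyond
    where
    js : ℕ → ℕ
    js zero    = proj₁ (star 0 n)
    js (suc i) = proj₁ (star (suc i) (suc (js i)))

    js-emb : ∀ i → A i ↪ A (js i)
    js-emb zero    = proj₂ (proj₂ (star 0 n))
    js-emb (suc i) = proj₂ (proj₂ (star (suc i) (suc (js i))))

    js-step : ∀ i → js i < js (suc i)
    js-step i = proj₁ (proj₂ (star (suc i) (suc (js i))))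

    js-beyond : ∀ i → n ≤ js i
    js-beyond zero    = proj₁ (proj₂ (star 0 n))
    js-beyond (suc i) = ≤-trans (js-beyond i) (<⇒≤ (js-step i))

    t : Car (Sum Index A) → Car (Sum Index A)
    t (i , x) = js i , proj₁ (js-emb i) x

    t-mono : ∀ x y → Sum Index A ∋ x ≺ y → Sum Index A ∋ t x ≺ t y
    t-mono _ _ (here p)          = here (R-stable js js-step p)
    t-mono (i , x) (_ , y) (there p) = there (proj₂ (js-emb i) x y p)

    t-beyond : ∀ x → n ≤ proj₁ (t x)
    t-beyond (i , _) = js-beyond i

open TailEmbedding _<_ <-isStrictTotalOrder stepwise-increasing⇒monotone
  renaming (TailMap to ω-TailMap; tail-embedding to ω-tail-embedding) using ()
open TailEmbedding (λ i j → j < i) (Flip.isStrictTotalOrder <-isStrictTotalOrder)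
  (λ h step {i} {j} → stepwise-increasing⇒monotone h step {j} {i})
  renaming (TailMap to ω*-TailMap; tail-embedding to ω*-tail-embedding) using ()

-- If M has a point c and monotone maps f, g landing strictly below,
-- resp. above c, then the tree of words, and hence η, embeds into M.
tree-embedding : ∀ M (c : Car M) (f g : Car M → Car M) →
  (∀ x y → M ∋ x ≺ y → M ∋ f x ≺ f y) → (∀ x y → M ∋ x ≺ y → M ∋ g x ≺ g y) →
  (∀ x → M ∋ f x ≺ c) → (∀ y → M ∋ c ≺ g y) → ηLO ↪ M
tree-embedding M c f g f-mono g-mono below above =
  (λ q → node (toWord q)) , λ p q p<q → node-mono (toWord-mono p q p<q)
  where
  node : Word → Car M
  node ε     = c
  node (l w) = f (node w)
  node (r w) = g (node w)

  node-mono : ∀ {u v} → u ⊏ v → M ∋ node u ≺ node v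
  node-mono l-ε     = below _
  node-mono ε-r     = above _
  node-mono l-r     = IsStrictTotalOrder.trans (isSTO M) (below _) (above _)
  node-mono (l-l p) = f-mono _ _ (node-mono p)
  node-mono (r-r p) = g-mono _ _ (node-mono p)

-- Inside an ω-sum, "move into summands ≥ 2" is a monotone map above the
-- point c in summand 1; inside an ω*-sum, "move into summands beyond that
-- of c" is a monotone map below c.
ωSum×ω*Sum⇒η↪ : ∀ {M} → IsωSum M → Isω*Sum M → ηLO ↪ M
ωSum×ω*Sum⇒η↪ {M} (A , hA , starA , φ , φ⁻¹ , _ , _ , φ-mono , φ⁻¹-mono)
                   (B , _ , starB , ψ , ψ⁻¹ , ψ⁻¹ψ , _ , ψ-mono , ψ⁻¹-mono) =
  tree-embedding M c f g
    (λ x y p → ψ⁻¹-mono _ _ (proj₁ (proj₂ tailB) _ _ (ψ-mono _ _ p)))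
    (λ x y p → φ⁻¹-mono _ _ (proj₁ (proj₂ tailA) _ _ (φ-mono _ _ p)))
    (λ x → subst (M ∋ f x ≺_) (ψ⁻¹ψ c)
             (ψ⁻¹-mono _ _ (SumConstr.here (proj₂ (proj₂ tailB) (ψ x)))))
    (λ y → φ⁻¹-mono _ _ (SumConstr.here (proj₂ (proj₂ tailA) (φ y))))
  where
  c : Car M
  c = φ⁻¹ (1 , point (hA 1))
  tailA : ω-TailMap A 2
  tailA = ω-tail-embedding A starA 2
  tailB : ω*-TailMap B (suc (proj₁ (ψ c)))
  tailB = ω*-tail-embedding B starB (suc (proj₁ (ψ c)))
  g f : Car M → Car M
  g x = φ⁻¹ (proj₁ tailA (φ x))
  f x = ψ⁻¹ (proj₁ tailB (ψ x))

One Inf : LinOrd → Set₁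
One M = Lift (lsuc 0ℓ) (IsOne M)
Inf M = Lift (lsuc 0ℓ) (Infinite M)

ωSum⇒ℋ : ∀ {M} → IsωSum M → ℋ M
ωSum⇒ℋ {M} (A , hA , starA , iso) = ℋ-ω M A hA starA iso

at-∷⁻ : ∀ {ℓ} {P : LinOrd → Set ℓ} X Ls {j} → At (X ∷ Ls) P (suc j) → At Ls P j
at-∷⁻ X Ls (s≤s p , h) = p , h

at-∷⁺ : ∀ {ℓ} {P : LinOrd → Set ℓ} X Ls {j} → At Ls P j → At (X ∷ Ls) P (suc j)
at-∷⁺ X Ls (p , h) = s≤s p , h

module FinSumLex (Ls : List LinOrd) = SumConstr (FinLO (length Ls)) (lookup Ls)
open FinSumLex using (here; there)
module ωLex (A : ℕ → LinOrd) = SumConstr ωLO A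

∷-cong : ∀ X Ys Ys' → FinSum Ys ≅ FinSum Ys' → FinSum (X ∷ Ys) ≅ FinSum (X ∷ Ys')
∷-cong X Ys Ys' (f , g , gf , fg , f-mono , _) =
  monotone-bijection⇒≅ {FinSum (X ∷ Ys)} {FinSum (X ∷ Ys')} (lift∷ f) (lift∷ g)
    (lift∷-inverse f g gf) (lift∷-inverse g f fg) mono
  where
  lift∷ : ∀ {Zs Zs'} → (Car (FinSum Zs) → Car (FinSum Zs')) →
          Car (FinSum (X ∷ Zs)) → Car (FinSum (X ∷ Zs'))
  lift∷ h (Fin.zero  , a) = Fin.zero , a
  lift∷ h (Fin.suc i , y) = Fin.suc (proj₁ (h (i , y))) , proj₂ (h (i , y))

  lift∷-inverse : ∀ {Zs Zs'} (h : Car (FinSum Zs) → Car (FinSum Zs'))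
    (h' : Car (FinSum Zs') → Car (FinSum Zs)) →
    (∀ z → h' (h z) ≡ z) → ∀ z → lift∷ {Zs'} {Zs} h' (lift∷ {Zs} {Zs'} h z) ≡ z
  lift∷-inverse h h' h'h (Fin.zero  , a) = refl
  lift∷-inverse h h' h'h (Fin.suc i , y) = cong (λ z → Fin.suc (proj₁ z) , proj₂ z) (h'h (i , y))

  shift : ∀ {a b} → FinSumLex.Lex Ys' a b →
    FinSumLex.Lex (X ∷ Ys') (Fin.suc (proj₁ a) , proj₂ a) (Fin.suc (proj₁ b) , proj₂ b)
  shift (here p)  = here (s≤s p)
  shift (there p) = there p

  mono : ∀ a b → FinSumLex.Lex (X ∷ Ys) a b → FinSumLex.Lex (X ∷ Ys') (lift∷ f a) (lift∷ f b)
  mono (Fin.zero , _)  (Fin.zero , _)  (there p)       = there p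
  mono (Fin.zero , _)  (Fin.suc _ , _) (here _)        = here (s≤s z≤n)
  mono (Fin.suc _ , _) (Fin.zero , _)  (here ())
  mono (Fin.suc _ , _) (Fin.suc _ , _) (here (s≤s p))  = shift (f-mono _ _ (here {Ys} p))
  mono (Fin.suc _ , _) (Fin.suc _ , _) (there p)       = shift (f-mono _ _ (there {Ys} p))

prepend : LinOrd → (ℕ → LinOrd) → ℕ → LinOrd
prepend X A zero    = X
prepend X A (suc n) = A n

singleton↪ : ∀ {X Y} → IsOne X → Car Y → X ↪ Y
singleton↪ {X} (_ , unique) y =
  (λ _ → y) , λ a b p → ⊥-elim (IsStrictTotalOrder.irrefl (isSTO X) (trans (unique a) (sym (unique b))) p)

-- x + W + R ≅ W' + R where W' = Σ_ω (x, A₀, A₁, …) is again an ω-sum.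
merge-singleton-ωSum : ∀ X W Rs → IsOne X → IsωSum W →
  Σ LinOrd λ W' → IsωSum W' × (FinSum (X ∷ W ∷ Rs) ≅ FinSum (W' ∷ Rs))
merge-singleton-ωSum X W Rs X-one (A , hA , starA , φ , φ⁻¹ , φ⁻¹φ , φφ⁻¹ , φ-mono , φ⁻¹-mono) =
  ΣωLO A' , (A' , hA' , starA' , ≅-refl {ΣωLO A'}) ,
  monotone-bijection⇒≅ {FinSum (X ∷ W ∷ Rs)} {FinSum (ΣωLO A' ∷ Rs)} F G GF FG F-mono
  where
  A' : ℕ → LinOrd
  A' = prepend X A

  hA' : ∀ i → ℋ (A' i)
  hA' zero    = ℋ-one X X-one
  hA' (suc i) = hA i

  starA' : Star A'
  starA' zero    N = suc N , n≤1+n N , singleton↪ {X} {A N} X-one (point (hA N))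
  starA' (suc i) N with starA i N
  ... | j , N≤j , emb = suc j , ≤-trans N≤j (n≤1+n j) , emb

  F : Car (FinSum (X ∷ W ∷ Rs)) → Car (FinSum (ΣωLO A' ∷ Rs))
  F (Fin.zero , a)           = Fin.zero , (0 , a)
  F (Fin.suc Fin.zero , w)   = Fin.zero , (suc (proj₁ (φ w)) , proj₂ (φ w))
  F (Fin.suc (Fin.suc i) , y) = Fin.suc i , y

  G : Car (FinSum (ΣωLO A' ∷ Rs)) → Car (FinSum (X ∷ W ∷ Rs))
  G (Fin.zero , (zero , a))  = Fin.zero , a
  G (Fin.zero , (suc n , b)) = Fin.suc Fin.zero , φ⁻¹ (n , b)
  G (Fin.suc i , y)          = Fin.suc (Fin.suc i) , y

  GF : ∀ z → G (F z) ≡ z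
  GF (Fin.zero , a)            = refl
  GF (Fin.suc Fin.zero , w)    = cong (Fin.suc Fin.zero ,_) (φ⁻¹φ w)
  GF (Fin.suc (Fin.suc i) , y) = refl

  FG : ∀ z → F (G z) ≡ z
  FG (Fin.zero , (zero , a))  = refl
  FG (Fin.zero , (suc n , b)) = cong (λ z → Fin.zero , (suc (proj₁ z) , proj₂ z)) (φφ⁻¹ (n , b))
  FG (Fin.suc i , y)          = refl

  shift : ∀ {a b} → ωLex.Lex A a b → ωLex.Lex A' (suc (proj₁ a) , proj₂ a) (suc (proj₁ b) , proj₂ b)
  shift (ωLex.here p)  = ωLex.here (s≤s p)
  shift (ωLex.there p) = ωLex.there p

  F-mono : ∀ a b → FinSumLex.Lex (X ∷ W ∷ Rs) a b → FinSumLex.Lex (ΣωLO A' ∷ Rs) (F a) (F b)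
  F-mono (Fin.zero , _) (Fin.zero , _)                   (there p)      = there (ωLex.there p)
  F-mono (Fin.zero , _) (Fin.suc Fin.zero , _)           (here _)       = there (ωLex.here (s≤s z≤n))
  F-mono (Fin.zero , _) (Fin.suc (Fin.suc _) , _)        (here _)       = here (s≤s z≤n)
  F-mono (Fin.suc _ , _) (Fin.zero , _)                  (here ())
  F-mono (Fin.suc Fin.zero , _) (Fin.suc Fin.zero , _)   (here (s≤s ()))
  F-mono (Fin.suc Fin.zero , _) (Fin.suc Fin.zero , _)   (there p)      = there (shift (φ-mono _ _ p))
  F-mono (Fin.suc Fin.zero , _) (Fin.suc (Fin.suc _) , _) (here _)      = here (s≤s z≤n)
  F-mono (Fin.suc (Fin.suc _) , _) (Fin.suc Fin.zero , _) (here (s≤s ()))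
  F-mono (Fin.suc (Fin.suc _) , _) (Fin.suc (Fin.suc _) , _) (here (s≤s p)) = here p
  F-mono (Fin.suc (Fin.suc _) , _) (Fin.suc (Fin.suc _) , _) (there p)      = there p

merge-at : ∀ j Ls → All ℋ Ls → At Ls One j → At Ls IsωSum (suc j) →
  Σ (List LinOrd) λ Ls' → suc (length Ls') ≡ length Ls × All ℋ Ls' × (FinSum Ls ≅ FinSum Ls')
merge-at zero [] _ (() , _) _
merge-at zero (_ ∷ []) _ _ (s≤s () , _)
merge-at zero (X ∷ W ∷ Rs) (_ ∷ _ ∷ hRs) (_ , lift X-one) (_ , W-ω)
  with merge-singleton-ωSum X W Rs X-one W-ω
... | W' , W'-ω , iso = W' ∷ Rs , refl , ωSum⇒ℋ W'-ω ∷ hRs , iso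
merge-at (suc j) [] _ (() , _) _
merge-at (suc j) (X ∷ Ls) (hX ∷ hLs) one ω
  with merge-at j Ls hLs (at-∷⁻ {P = One} X Ls one) (at-∷⁻ {P = IsωSum} X Ls ω)
... | Ls' , len , hLs' , iso = X ∷ Ls' , cong suc len , hX ∷ hLs' , ∷-cong X Ls Ls' iso

at-drop⁻ : ∀ {P : LinOrd → Set₁} n Ls {j} → At Ls P (n + j) → At (drop n Ls) P j
at-drop⁻ zero    Ls       a       = a
at-drop⁻ (suc n) []       (() , _)
at-drop⁻ {P} (suc n) (X ∷ Ls) a   = at-drop⁻ {P} n Ls (at-∷⁻ {P = P} X Ls a)

at-drop⁺ : ∀ {P : LinOrd → Set₁} n Ls {j} → At (drop n Ls) P j → At Ls P (n + j)
at-drop⁺ zero    Ls       a       = a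
at-drop⁺ (suc n) []       (() , _)
at-drop⁺ {P} (suc n) (X ∷ Ls) a   = at-∷⁺ {P = P} X Ls (at-drop⁺ {P} n Ls a)

allIn-at : ∀ {P : LinOrd → Set₁} Ls i k → AllIn Ls P i k → ∀ {j} → j ≤ k → At Ls P (i + j)
allIn-at Ls i k all {j} j≤k = all (i + j) (m≤m+n i j) (+-monoʳ-≤ i j≤k)

allIn-head : ∀ {P : LinOrd → Set₁} Ls i k → AllIn Ls P i k → At Ls P i
allIn-head Ls i k all = all i ≤-refl (m≤m+n i k)

allIn-second : ∀ {P : LinOrd → Set₁} Ls i k → AllIn Ls P i (suc k) → At Ls P (suc i)
allIn-second {P} Ls i k all = subst (At Ls P) (+-comm i 1) (allIn-at {P} Ls i (suc k) all (s≤s z≤n))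

allIn-∷⁻ : ∀ {P : LinOrd → Set₁} X Ls {i k} → AllIn (X ∷ Ls) P (suc i) k → AllIn Ls P i k
allIn-∷⁻ {P} X Ls all j i≤j j≤i+k = at-∷⁻ {P = P} X Ls (all (suc j) (s≤s i≤j) (s≤s j≤i+k))

allIn-∷⁺ : ∀ {P : LinOrd → Set₁} X Ls {i k} → AllIn Ls P i k → AllIn (X ∷ Ls) P (suc i) k
allIn-∷⁺ {P} X Ls all (suc j) (s≤s i≤j) (s≤s j≤i+k) = at-∷⁺ {P = P} X Ls (all j i≤j j≤i+k)

-- The four kinds of blocks (A)–(D): a maximal run of singletons, of
-- ω-sums, of ω*-sums, and an ω*-sum followed by an ω-sum.
data Shape : Set where
  singletons ωsums ω*sums ω*ω : Shape

-- The conditions a block L_i + ⋯ + L_{i+k} puts on L_i, L_{i+1}, ….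
data Core : Shape → List LinOrd → ℕ → ℕ → Set₁ where
  singletons : ∀ {Ls i k} → AllIn Ls One i k →
    (IsLast Ls i k ⊎ At Ls Inf (suc (i + k))) → Core singletons Ls i k
  ωsums : ∀ {Ls i k} → AllIn Ls IsωSum i k →
    (IsLast Ls i k ⊎ At Ls NotωSum (suc (i + k))) → Core ωsums Ls i k
  ω*sums : ∀ {Ls i k} → AllIn Ls Isω*Sum i k →
    (IsLast Ls i k ⊎ (At Ls Isω*Sum (suc (i + k)) × At Ls IsωSum (suc (suc (i + k))))) →
    Core ω*sums Ls i k
  ω*ω : ∀ {Ls i} → At Ls Isω*Sum i → At Ls IsωSum (suc i) → Core ω*ω Ls i 1

-- The conditions it puts on L_{i-1}, L_{i-2}.
Left : Shape → List LinOrd → ℕ → Set₁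
Left singletons Ls i = i ≡ 0 ⊎ Σ ℕ λ j → i ≡ suc j × At Ls Inf j
Left ωsums      Ls i = i ≡ 0 ⊎ Σ ℕ λ j → i ≡ suc (suc j) × At Ls IsωSum (suc j) × At Ls Isω*Sum j
Left ω*sums     Ls i = i ≡ 0 ⊎ Σ ℕ λ j → i ≡ suc j × At Ls Notω*Sum j
Left ω*ω        Ls i = ⊤

block⇒core×left : ∀ {Ls i k} → IsBlock Ls i k → Σ Shape λ s → Core s Ls i k × Left s Ls i
block⇒core×left (inj₁ (all , left , right))               = singletons , singletons all right , left
block⇒core×left (inj₂ (inj₁ (all , left , right)))        = ωsums , ωsums all right , left
block⇒core×left (inj₂ (inj₂ (inj₁ (all , left , right)))) = ω*sums , ω*sums all right , left
block⇒core×left (inj₂ (inj₂ (inj₂ (refl , s , w))))       = ω*ω , ω*ω s w , _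

core×left⇒block : ∀ {s Ls i k} → Core s Ls i k → Left s Ls i → IsBlock Ls i k
core×left⇒block (singletons all right) left = inj₁ (all , left , right)
core×left⇒block (ωsums all right)      left = inj₂ (inj₁ (all , left , right))
core×left⇒block (ω*sums all right)     left = inj₂ (inj₂ (inj₁ (all , left , right)))
core×left⇒block (ω*ω s w)              _    = inj₂ (inj₂ (inj₂ (refl , s , w)))

Head : Shape → LinOrd → Set₁
Head singletons = One
Head ωsums      = IsωSum
Head ω*sums     = Isω*Sum
Head ω*ω        = Isω*Sum

core-head : ∀ {s Ls i k} → Core s Ls i k → At Ls (Head s) i
core-head {Ls = Ls} {i} {k} (singletons all _) = allIn-head {One} Ls i k all
core-head {Ls = Ls} {i} {k} (ωsums all _)      = allIn-head {IsωSum} Ls i k all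
core-head {Ls = Ls} {i} {k} (ω*sums all _)     = allIn-head {Isω*Sum} Ls i k all
core-head                   (ω*ω s _)          = s

core-∷⁻ : ∀ {s} X Ls {i k} → Core s (X ∷ Ls) (suc i) k → Core s Ls i k
core-∷⁻ X Ls (singletons all right) =
  singletons (allIn-∷⁻ {One} X Ls all) (⊎-map suc-injective (at-∷⁻ {P = Inf} X Ls) right)
core-∷⁻ X Ls (ωsums all right) =
  ωsums (allIn-∷⁻ {IsωSum} X Ls all) (⊎-map suc-injective (at-∷⁻ {P = NotωSum} X Ls) right)
core-∷⁻ X Ls (ω*sums all right) =
  ω*sums (allIn-∷⁻ {Isω*Sum} X Ls all)
    (⊎-map suc-injective (λ (s , w) → at-∷⁻ {P = Isω*Sum} X Ls s , at-∷⁻ {P = IsωSum} X Ls w) right)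
core-∷⁻ X Ls (ω*ω s w) = ω*ω (at-∷⁻ {P = Isω*Sum} X Ls s) (at-∷⁻ {P = IsωSum} X Ls w)

core-∷⁺ : ∀ {s} X Ls {i k} → Core s Ls i k → Core s (X ∷ Ls) (suc i) k
core-∷⁺ X Ls (singletons all right) =
  singletons (allIn-∷⁺ {One} X Ls all) (⊎-map (cong suc) (at-∷⁺ {P = Inf} X Ls) right)
core-∷⁺ X Ls (ωsums all right) =
  ωsums (allIn-∷⁺ {IsωSum} X Ls all) (⊎-map (cong suc) (at-∷⁺ {P = NotωSum} X Ls) right)
core-∷⁺ X Ls (ω*sums all right) =
  ω*sums (allIn-∷⁺ {Isω*Sum} X Ls all)
    (⊎-map (cong suc) (λ (s , w) → at-∷⁺ {P = Isω*Sum} X Ls s , at-∷⁺ {P = IsωSum} X Ls w) right)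
core-∷⁺ X Ls (ω*ω s w) = ω*ω (at-∷⁺ {P = Isω*Sum} X Ls s) (at-∷⁺ {P = IsωSum} X Ls w)

core-nonempty : ∀ {s i k} → ¬ Core s [] i k
core-nonempty core with core-head core
... | () , _

core-drop⁻ : ∀ {s} n Ls {i k} → Core s Ls (n + i) k → Core s (drop n Ls) i k
core-drop⁻ zero    Ls       core = core
core-drop⁻ (suc n) []       core = ⊥-elim (core-nonempty core)
core-drop⁻ (suc n) (X ∷ Ls) core = core-drop⁻ n Ls (core-∷⁻ X Ls core)

core-drop⁺ : ∀ {s} n Ls {i k} → Core s (drop n Ls) i k → Core s Ls (n + i) k
core-drop⁺ zero    Ls       core = core
core-drop⁺ (suc n) []       core = ⊥-elim (core-nonempty core)
core-drop⁺ (suc n) (X ∷ Ls) core = core-∷⁺ X Ls (core-drop⁺ n Ls core)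

left-zero : ∀ s Ls → Left s Ls 0
left-zero singletons _ = inj₁ refl
left-zero ωsums      _ = inj₁ refl
left-zero ω*sums     _ = inj₁ refl
left-zero ω*ω        _ = _

+-suc-injective : ∀ n j {j'} → n + suc j ≡ suc j' → j' ≡ n + j
+-suc-injective n j e = suc-injective (trans (sym e) (+-suc n j))

left-drop⁺ : ∀ s n Ls {j} → Left s (drop n Ls) (suc j) → Left s Ls (n + suc j)
left-drop⁺ singletons n Ls {j} (inj₂ (_ , refl , inf)) = inj₂ (n + j , +-suc n j , at-drop⁺ {Inf} n Ls inf)
left-drop⁺ ωsums n Ls (inj₂ (j , refl , w , s)) =
  inj₂ (n + j , trans (+-suc n (suc j)) (cong suc (+-suc n j)) ,
        subst (At Ls IsωSum) (+-suc n j) (at-drop⁺ {IsωSum} n Ls w) , at-drop⁺ {Isω*Sum} n Ls s)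
left-drop⁺ ω*sums n Ls {j} (inj₂ (_ , refl , ns)) = inj₂ (n + j , +-suc n j , at-drop⁺ {Notω*Sum} n Ls ns)
left-drop⁺ ω*ω _ _ _ = _

-- Conversely, when dropping the first K+1 summands; the only condition
-- that can fail is an ω-block at the new position 1 relying on
-- L_K (an ω*-sum) and L_{K+1} (an ω-sum), which the hypothesis excludes.
left-drop⁻ : ∀ s K Ls {j} → (At Ls Isω*Sum K → At Ls IsωSum (suc K) → ⊥) →
  Left s Ls (suc K + suc j) → Left s (drop (suc K) Ls) (suc j)
left-drop⁻ singletons K Ls {j} _ (inj₂ (_ , e , inf)) =
  inj₂ (j , refl , at-drop⁻ {Inf} (suc K) Ls (subst (At Ls Inf) (+-suc-injective (suc K) j e) inf))
left-drop⁻ ωsums K Ls {zero} boundary (inj₂ (j , e , w , s)) =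
  ⊥-elim (boundary (subst (At Ls Isω*Sum) j≡K s) (subst (λ j → At Ls IsωSum (suc j)) j≡K w))
  where
  j≡K : j ≡ K
  j≡K = trans (suc-injective (+-suc-injective (suc K) 0 e)) (+-identityʳ K)
left-drop⁻ ωsums K Ls {suc j} _ (inj₂ (j' , e , w , s)) =
  inj₂ (j , refl , at-drop⁻ {IsωSum} (suc K) Ls (subst (At Ls IsωSum) sj'≡ w) ,
                   at-drop⁻ {Isω*Sum} (suc K) Ls (subst (At Ls Isω*Sum) (+-suc-injective (suc K) j (sym sj'≡)) s))
  where
  sj'≡ : suc j' ≡ suc K + suc j
  sj'≡ = +-suc-injective (suc K) (suc j) e
left-drop⁻ ω*sums K Ls {j} _ (inj₂ (_ , e , ns)) =
  inj₂ (j , refl , at-drop⁻ {Notω*Sum} (suc K) Ls (subst (At Ls Notω*Sum) (+-suc-injective (suc K) j e) ns))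
left-drop⁻ ω*ω _ _ _ _ = _

at-exclusive : ∀ {P Q : LinOrd → Set₁} {Ls j} → (∀ M → P M → Q M → ⊥) → At Ls P j → At Ls Q j → ⊥
at-exclusive excl (_ , h) (_ , h') = excl _ h h'

at-map : ∀ {P Q : LinOrd → Set₁} {Ls j} → (∀ M → P M → Q M) → At Ls P j → At Ls Q j
at-map f (p , h) = p , f _ h

module Positions (Ls : List LinOrd) where

  past-end : ∀ i k → IsLast Ls i k → ¬ suc (i + k) < length Ls
  past-end _ _ last = <-irrefl last

  one-inf : ∀ {j} → At Ls One j → At Ls Inf j → ⊥
  one-inf = at-exclusive {One} {Inf} {Ls} λ M one inf → lower inf (singleton-finite {M} (lower one))

  one-ω : ∀ {j} → At Ls One j → At Ls IsωSum j → ⊥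
  one-ω = at-exclusive {One} {IsωSum} {Ls} λ M one w → ωSum-infinite {M} w (singleton-finite {M} (lower one))

  one-ω* : ∀ {j} → At Ls One j → At Ls Isω*Sum j → ⊥
  one-ω* = at-exclusive {One} {Isω*Sum} {Ls} λ M one s → ω*Sum-infinite {M} s (singleton-finite {M} (lower one))

  ω-notω : ∀ {j} → At Ls IsωSum j → At Ls NotωSum j → ⊥
  ω-notω = at-exclusive {IsωSum} {NotωSum} {Ls} λ _ w nw → nw w

  ω*-notω* : ∀ {j} → At Ls Isω*Sum j → At Ls Notω*Sum j → ⊥
  ω*-notω* = at-exclusive {Isω*Sum} {Notω*Sum} {Ls} λ _ s ns → ns s

  ω⇒inf : ∀ {j} → At Ls IsωSum j → At Ls Inf j
  ω⇒inf = at-map {IsωSum} {Inf} {Ls} λ M w → lift (ωSum-infinite {M} w)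

  ω*⇒inf : ∀ {j} → At Ls Isω*Sum j → At Ls Inf j
  ω*⇒inf = at-map {Isω*Sum} {Inf} {Ls} λ M s → lift (ω*Sum-infinite {M} s)

  one⇒notω* : ∀ {j} → At Ls One j → At Ls Notω*Sum j
  one⇒notω* = at-map {One} {Notω*Sum} {Ls} λ M one s → ω*Sum-infinite {M} s (singleton-finite {M} (lower one))

  singletons-maximal : ∀ {i k} → Core singletons Ls i k → ¬ At Ls One (suc (i + k))
  singletons-maximal {i} {k} (singletons _ (inj₁ last)) one = past-end i k last (proj₁ one)
  singletons-maximal         (singletons _ (inj₂ inf))  one = one-inf one inf

  ωsums-maximal : ∀ {i k} → Core ωsums Ls i k → ¬ At Ls IsωSum (suc (i + k))
  ωsums-maximal {i} {k} (ωsums _ (inj₁ last)) w = past-end i k last (proj₁ w)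
  ωsums-maximal         (ωsums _ (inj₂ nw))   w = ω-notω w nw

  same-length : ∀ {s} → (∀ {k K} → Core s Ls 0 K → Core s Ls 0 k → k < K → ⊥) →
    ∀ {k K} → Core s Ls 0 k → Core s Ls 0 K → k ≡ K
  same-length shorter {k} {K} c c' with <-cmp k K
  ... | tri< k<K _ _ = ⊥-elim (shorter c' c k<K)
  ... | tri≈ _ k≡K _ = k≡K
  ... | tri> _ _ K<k = ⊥-elim (shorter c c' K<k)

  singletons-shorter : ∀ {k K} → Core singletons Ls 0 K → Core singletons Ls 0 k → k < K → ⊥
  singletons-shorter (singletons all _) c k<K = singletons-maximal c (all _ z≤n k<K)

  ωsums-shorter : ∀ {k K} → Core ωsums Ls 0 K → Core ωsums Ls 0 k → k < K → ⊥
  ωsums-shorter (ωsums all _) c k<K = ωsums-maximal c (all _ z≤n k<K)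

module Decomposition {m L} (cs : CS m L) {Ls} (len : length Ls ≡ m)
                     (hs : All ℋ Ls) (iso : L ≅ FinSum Ls) where

  open Positions Ls

  summand↪ : ∀ {j} (p : j < length Ls) → lookup Ls (Fin.fromℕ< p) ↪ L
  summand↪ p = (λ x → proj₁ (proj₂ iso) (Fin.fromℕ< p , x)) ,
               λ x y x<y → proj₂ (proj₂ (proj₂ (proj₂ (proj₂ iso)))) _ _ (there {Ls} x<y)

  -- L is scattered, so no summand is both an ω-sum and an ω*-sum.
  ω-ω* : ∀ {j} → At Ls IsωSum j → At Ls Isω*Sum j → ⊥
  ω-ω* (p , w) (_ , s) = proj₁ (proj₂ cs) (↪-trans {ηLO} {Lₚ} {L} (ωSum×ω*Sum⇒η↪ {Lₚ} w s) (summand↪ p))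
    where
    Lₚ : LinOrd
    Lₚ = lookup Ls (Fin.fromℕ< p)

  ω⇒notω* : ∀ {j} → At Ls IsωSum j → At Ls Notω*Sum j
  ω⇒notω* (p , w) = p , λ s → ω-ω* (p , w) (p , s)

  -- m is minimal, so no singleton is directly followed by an ω-sum.
  no-singleton-before-ωSum : ∀ {j} → At Ls One j → At Ls IsωSum (suc j) → ⊥
  no-singleton-before-ωSum {j} one w with merge-at j Ls hs one w
  ... | Ls' , shorter , hs' , iso' =
    1+n≰n (subst (_≤ length Ls') (trans (sym len) (sym shorter))
      (proj₂ (proj₂ (proj₂ cs)) (length Ls') (Ls' , refl , hs' , ≅-trans {L} {FinSum Ls} {FinSum Ls'} iso iso')))

  ω*sums-stop : ∀ {i k} → Core ω*sums Ls i k → ¬ At Ls IsωSum (suc (i + k))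
  ω*sums-stop {i} {k} (ω*sums _ (inj₁ last))    w = past-end i k last (proj₁ w)
  ω*sums-stop         (ω*sums _ (inj₂ (s , _))) w = ω-ω* w s

  ω*sums-second : ∀ {i k} → Core ω*sums Ls i k → ¬ At Ls IsωSum (suc i)
  ω*sums-second {i} {zero} c w =
    ω*sums-stop c (subst (λ j → At Ls IsωSum (suc j)) (sym (+-identityʳ i)) w)
  ω*sums-second {i} {suc k} (ω*sums all _) w = ω-ω* w (allIn-second {Isω*Sum} Ls i k all)

  ω*sums-shorter : ∀ {k K} → Core ω*sums Ls 0 K → Core ω*sums Ls 0 k → k < K → ⊥
  ω*sums-shorter (ω*sums all _) (ω*sums _ (inj₁ last)) k<K = past-end 0 _ last (proj₁ (all _ z≤n k<K))
  ω*sums-shorter c@(ω*sums all _) (ω*sums _ (inj₂ (_ , w))) k<K with m≤n⇒m<n∨m≡n k<K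
  ... | inj₁ 1+k<K = ω-ω* w (all _ z≤n 1+k<K)
  ... | inj₂ refl  = ω*sums-stop c w

  -- No block starts at a position 1 ≤ i ≤ K inside the first block
  -- L_0 + ⋯ + L_K: its first summand, or the summand before it, has the
  -- kind of the first block, which contradicts its core or left condition.
  inside-first : ∀ {s₀ K} → Core s₀ Ls 0 K →
    ∀ {s i k} → Core s Ls (suc i) k → Left s Ls (suc i) → suc i ≤ K → ⊥
  inside-first (singletons all₀ _) (singletons _ _) (inj₂ (_ , refl , inf)) le =
    one-inf (all₀ _ z≤n (≤-trans (n≤1+n _) le)) inf
  inside-first (singletons all₀ _) c@(ωsums _ _)  _ le = one-ω (all₀ _ z≤n le) (core-head c)
  inside-first (singletons all₀ _) c@(ω*sums _ _) _ le = one-ω* (all₀ _ z≤n le) (core-head c)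
  inside-first (singletons all₀ _) (ω*ω s _)      _ le = one-ω* (all₀ _ z≤n le) s
  inside-first (ωsums all₀ _) c@(singletons _ _)  _ le = one-ω (core-head c) (all₀ _ z≤n le)
  inside-first (ωsums all₀ _) (ωsums _ _) (inj₂ (j , refl , _ , s)) le =
    ω-ω* (all₀ _ z≤n (≤-trans (m≤n+m j 2) le)) s
  inside-first (ωsums all₀ _) c@(ω*sums _ _) _ le = ω-ω* (all₀ _ z≤n le) (core-head c)
  inside-first (ωsums all₀ _) (ω*ω s _)      _ le = ω-ω* (all₀ _ z≤n le) s
  inside-first (ω*sums all₀ _) c@(singletons _ _) _ le = one-ω* (core-head c) (all₀ _ z≤n le)
  inside-first (ω*sums all₀ _) c@(ωsums _ _)      _ le = ω-ω* (core-head c) (all₀ _ z≤n le)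
  inside-first (ω*sums all₀ _) (ω*sums _ _) (inj₂ (_ , refl , ns)) le =
    ω*-notω* (all₀ _ z≤n (≤-trans (n≤1+n _) le)) ns
  inside-first c₀@(ω*sums all₀ _) (ω*ω _ w) _ le with m≤n⇒m<n∨m≡n le
  ... | inj₁ 1+i<K = ω-ω* w (all₀ _ z≤n 1+i<K)
  ... | inj₂ refl  = ω*sums-stop c₀ w
  inside-first (ω*ω _ w₁) c@(singletons _ _) _ (s≤s z≤n) = one-ω (core-head c) w₁
  inside-first (ω*ω _ _)  (ωsums _ _) (inj₂ (_ , () , _)) (s≤s z≤n)
  inside-first (ω*ω _ w₁) c@(ω*sums _ _) _ (s≤s z≤n) = ω-ω* w₁ (core-head c)
  inside-first (ω*ω _ w₁) (ω*ω s _)      _ (s≤s z≤n) = ω-ω* w₁ s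
  inside-first _ (singletons _ _) (inj₁ ()) _
  inside-first _ (ωsums _ _)      (inj₁ ()) _
  inside-first _ (ω*sums _ _)     (inj₁ ()) _

  same-start : ∀ {s₀ K} → Core s₀ Ls 0 K → ∀ {s k} → Core s Ls 0 k → k ≡ K
  same-start c₀@(singletons _ _) c@(singletons _ _) = same-length singletons-shorter c c₀
  same-start c₀@(ωsums _ _)      c@(ωsums _ _)      = same-length ωsums-shorter c c₀
  same-start c₀@(ω*sums _ _)     c@(ω*sums _ _)     = same-length ω*sums-shorter c c₀
  same-start (ω*ω _ _)           (ω*ω _ _)          = refl
  same-start c₀@(ω*sums _ _)     (ω*ω _ w)          = ⊥-elim (ω*sums-second c₀ w)
  same-start (ω*ω _ w)           c@(ω*sums _ _)     = ⊥-elim (ω*sums-second c w)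
  same-start c₀@(singletons _ _) c@(ωsums _ _)      = ⊥-elim (one-ω (core-head c₀) (core-head c))
  same-start c₀@(singletons _ _) c@(ω*sums _ _)     = ⊥-elim (one-ω* (core-head c₀) (core-head c))
  same-start c₀@(singletons _ _) c@(ω*ω _ _)        = ⊥-elim (one-ω* (core-head c₀) (core-head c))
  same-start c₀@(ωsums _ _)      c@(singletons _ _) = ⊥-elim (one-ω (core-head c) (core-head c₀))
  same-start c₀@(ωsums _ _)      c@(ω*sums _ _)     = ⊥-elim (ω-ω* (core-head c₀) (core-head c))
  same-start c₀@(ωsums _ _)      c@(ω*ω _ _)        = ⊥-elim (ω-ω* (core-head c₀) (core-head c))
  same-start c₀@(ω*sums _ _)     c@(singletons _ _) = ⊥-elim (one-ω* (core-head c) (core-head c₀))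
  same-start c₀@(ω*sums _ _)     c@(ωsums _ _)      = ⊥-elim (ω-ω* (core-head c) (core-head c₀))
  same-start c₀@(ω*ω _ _)        c@(singletons _ _) = ⊥-elim (one-ω* (core-head c) (core-head c₀))
  same-start c₀@(ω*ω _ _)        c@(ωsums _ _)      = ⊥-elim (ω-ω* (core-head c) (core-head c₀))

  no-ω*ω-after-first : ∀ {s₀ K} → Core s₀ Ls 0 K → At Ls Isω*Sum K → At Ls IsωSum (suc K) → ⊥
  no-ω*ω-after-first (singletons all₀ _) s _ = one-ω* (all₀ _ z≤n ≤-refl) s
  no-ω*ω-after-first c₀@(ωsums _ _)      _ w = ωsums-maximal c₀ w
  no-ω*ω-after-first c₀@(ω*sums _ _)     _ w = ω*sums-stop c₀ w
  no-ω*ω-after-first (ω*ω _ w₁)          s _ = ω-ω* w₁ s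

  -- A block starting right after the first block satisfies its left
  -- condition.  For a run of ω-sums after a run of singletons this is where
  -- the minimality of m is needed.
  left-after-first : ∀ {s₀ K} → Core s₀ Ls 0 K → ∀ {s k} → Core s Ls (suc K) k → Left s Ls (suc K)
  left-after-first c₀@(singletons _ _) c@(singletons _ _) = ⊥-elim (singletons-maximal c₀ (core-head c))
  left-after-first (ωsums all₀ _)  (singletons _ _) = inj₂ (_ , refl , ω⇒inf (all₀ _ z≤n ≤-refl))
  left-after-first (ω*sums all₀ _) (singletons _ _) = inj₂ (_ , refl , ω*⇒inf (all₀ _ z≤n ≤-refl))
  left-after-first (ω*ω _ w₁)      (singletons _ _) = inj₂ (_ , refl , ω⇒inf w₁)
  left-after-first (singletons all₀ _) c@(ωsums _ _) =
    ⊥-elim (no-singleton-before-ωSum (all₀ _ z≤n ≤-refl) (core-head c))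
  left-after-first c₀@(ωsums _ _)  c@(ωsums _ _) = ⊥-elim (ωsums-maximal c₀ (core-head c))
  left-after-first c₀@(ω*sums _ _) c@(ωsums _ _) = ⊥-elim (ω*sums-stop c₀ (core-head c))
  left-after-first (ω*ω s₀ w₁)     (ωsums _ _)   = inj₂ (0 , refl , w₁ , s₀)
  left-after-first (singletons all₀ _) (ω*sums _ _) = inj₂ (_ , refl , one⇒notω* (all₀ _ z≤n ≤-refl))
  left-after-first (ωsums all₀ _)      (ω*sums _ _) = inj₂ (_ , refl , ω⇒notω* (all₀ _ z≤n ≤-refl))
  left-after-first (ω*ω _ w₁)          (ω*sums _ _) = inj₂ (_ , refl , ω⇒notω* w₁)
  left-after-first {K = K} (ω*sums _ (inj₁ last)) c@(ω*sums _ _) =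
    ⊥-elim (past-end 0 K last (proj₁ (core-head c)))
  left-after-first (ω*sums _ (inj₂ (_ , w))) c@(ω*sums _ _) = ⊥-elim (ω*sums-second c w)
  left-after-first _ (ω*ω _ _) = _

  first-block-unique : ∀ {K} → IsBlock Ls 0 K → ∀ {i k} → IsBlock Ls i k → i ≤ K → (i , k) ≡ (0 , K)
  first-block-unique b₀ {zero} b _ with block⇒core×left b₀ | block⇒core×left b
  ... | _ , c₀ , _ | _ , c , _ = cong (0 ,_) (same-start c₀ c)
  first-block-unique b₀ {suc i} b le with block⇒core×left b₀ | block⇒core×left b
  ... | _ , c₀ , _ | _ , c , left = ⊥-elim (inside-first c₀ c left le)

  after-first⇒ : ∀ {K} → IsBlock Ls 0 K → ∀ {j k} → IsBlock Ls (suc K + j) k → IsBlock (drop (suc K) Ls) j k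
  after-first⇒ {K} b₀ {j} b with block⇒core×left b₀ | block⇒core×left b
  ... | _ , c₀ , _ | s , c , left = core×left⇒block (core-drop⁻ (suc K) Ls c) (left-after j left)
    where
    left-after : ∀ j → Left s Ls (suc K + j) → Left s (drop (suc K) Ls) j
    left-after zero    _    = left-zero s _
    left-after (suc j) left = left-drop⁻ s K Ls (no-ω*ω-after-first c₀) left

  after-first⇐ : ∀ {K} → IsBlock Ls 0 K → ∀ {j k} → IsBlock (drop (suc K) Ls) j k → IsBlock Ls (suc K + j) k
  after-first⇐ {K} b₀ {zero} {k} b with block⇒core×left b₀ | block⇒core×left b
  ... | _ , c₀ , _ | s , c , _ =
    subst (λ i → IsBlock Ls i k) (sym (+-identityʳ (suc K))) (core×left⇒block c' (left-after-first c₀ c'))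
    where
    c' : Core s Ls (suc K) k
    c' = subst (λ i → Core s Ls i k) (+-identityʳ (suc K)) (core-drop⁺ (suc K) Ls c)
  after-first⇐ {K} b₀ {suc j} b with block⇒core×left b
  ... | s , c , left = core×left⇒block (core-drop⁺ (suc K) Ls c) (left-drop⁺ s (suc K) Ls left)

lemma6p4 : (m : ℕ) (L : LinOrd) → CS m L →
           (Ls : List LinOrd) → length Ls ≡ m → All ℋ Ls → L ≅ FinSum Ls →
           (k₀ : ℕ) → IsBlock Ls 0 k₀ →
           ∀ i k → ((IsBlock Ls i k × ¬ ((i , k) ≡ (0 , k₀))) ⇔
                    Σ ℕ (λ j → (i ≡ suc k₀ + j) × IsBlock (drop (suc k₀) Ls) j k))
lemma6p4 m L cs Ls len hs iso k₀ b₀ i k = mk⇔ other-block⇒ ⇒other-block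
  where
  open Decomposition {m} {L} cs {Ls} len hs iso

  other-block⇒ : IsBlock Ls i k × ¬ ((i , k) ≡ (0 , k₀)) →
                 Σ ℕ (λ j → (i ≡ suc k₀ + j) × IsBlock (drop (suc k₀) Ls) j k)
  other-block⇒ (b , not-first) with i ≤? k₀
  ... | yes i≤k₀ = ⊥-elim (not-first (first-block-unique b₀ b i≤k₀))
  ... | no  i≰k₀ = i ∸ suc k₀ , i≡ , after-first⇒ b₀ (subst (λ i → IsBlock Ls i k) i≡ b)
    where
    i≡ : i ≡ suc k₀ + (i ∸ suc k₀)
    i≡ = sym (m+[n∸m]≡n (≰⇒> i≰k₀))

  ⇒other-block : Σ ℕ (λ j → (i ≡ suc k₀ + j) × IsBlock (drop (suc k₀) Ls) j k) →
                 IsBlock Ls i k × ¬ ((i , k) ≡ (0 , k₀))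
  ⇒other-block (j , refl , b) = after-first⇐ b₀ b , λ ()
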